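{- For all integers $n\geq0$, $b_{2,2}(n)\geq b_{2,3}(n)$.
   Context: A $2$-regular partition of $n$ is a partition of $n$ with no even parts (i.e. a partition into odd parts). The hook length of a box in the Young diagram of a partition (rows of lengths $\lambda_1\geq\lambda_2\geq\cdots$, left-justified) is the number of boxes directly to its right plus the number directly below it plus $1$. For $k\geq1$, $b_{2,k}(n)$ denotes the total number of boxes of hook length $k$, counted over all $2$-regular partitions of $n$ (with $b_{2,k}(0)=0$). -}

module Defs where

open import Data.Nat using (ℕ; zero; suc; _+_; _∸_; _≡ᵇ_; _<ᵇ_; _≤_)
open import Data.Nat.Base using (_%_)
open import Data.Bool using (Bool; true; false; if_then_else_)
open import Data.Nat.ListAction using (sum)
open import Data.List using (List; []; _∷_; length; map; upTo; concatMap; filter; zip; foldr)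
open import Data.List.Relation.Unary.All using (All)
open import Data.Product using (_,_; _×_)
open import Relation.Nullary.Decidable using (does)
open import Relation.Binary.PropositionalEquality using (_≡_)

-- A partition is represented as a weakly decreasing list of positive parts
-- λ₁ ≥ λ₂ ≥ ⋯ ≥ 1.

-- partsBounded fuel n m : all weakly decreasing lists of positive integers,
-- every part ≤ m, summing to n (fuel ≥ n ensures completeness).
partsBounded : ℕ → ℕ → ℕ → List (List ℕ)
partsBounded _        zero    m = [] ∷ []
partsBounded zero     (suc n) m = []
partsBounded (suc f)  (suc n) m =
  concatMap (λ p → map (suc p ∷_) (partsBounded f (suc n ∸ suc p) (suc p)))
            (filter (λ p → suc p Data.Nat.≤? m) (upTo (suc n)))

partitions : ℕ → List (List ℕ)
partitions n = partsBounded n n n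

isOdd : ℕ → Bool
isOdd k = k % 2 ≡ᵇ 1

allB : List ℕ → Bool
allB []       = true
allB (x ∷ xs) = if isOdd x then allB xs else false

regular2Partitions : ℕ → List (List ℕ)
regular2Partitions n = filter (λ λs → allB λs Data.Bool.≟ true) (partitions n)

-- λ'_j : number of parts strictly larger than j (length of column j, 0-indexed).
colLen : List ℕ → ℕ → ℕ
colLen []       j = 0
colLen (x ∷ xs) j = (if j <ᵇ x then 1 else 0) + colLen xs j

-- Hook length of the box in row i, column j (0-indexed) of λ whose row i has
-- length r: (arm) (r - j - 1) + (leg) (λ'_j - i - 1) + 1.
hook : List ℕ → ℕ → ℕ → ℕ → ℕ
hook λs i r j = (r ∸ j ∸ 1) + (colLen λs j ∸ i ∸ 1) + 1

indicator : Bool → ℕ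
indicator true  = 1
indicator false = 0

hooksEq : ℕ → List ℕ → ℕ
hooksEq k λs =
  sum (map (λ ir → rowCount (Data.Product.proj₁ ir) (Data.Product.proj₂ ir))
           (zip (upTo (length λs)) λs))
  where
  rowCount : ℕ → ℕ → ℕ
  rowCount i r = sum (map (λ j → indicator (hook λs i r j ≡ᵇ k)) (upTo r))

b2 : ℕ → ℕ → ℕ
b2 k n = sum (map (hooksEq k) (regular2Partitions n))

-- Group the 2-regular partitions λ of n by their largest part v, which is odd, and write λ = v ∷ μ.
-- The hooks of λ are those of μ together with those of the top row, so by induction on n it suffices to
-- compare top rows.  For v = 1, λ is a single column, which has one box of each hook length 1, …, n.
-- For v = t + 3, only the last three boxes of the top row can have hook length ≤ 3; their hooks are
-- 3 + μ'_t, 2 + μ'_(t+1) and 1 + μ'_(t+2).  Now split the μ by their own largest part: if it is ≤ t the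
-- top row has one 2-hook and one 3-hook; if it is t + 1 it has a 2-hook and no 3-hook; if it is t + 3 it
-- has at most as many 3-hooks as 2-hooks, plus one if μ has exactly two parts t + 3.  Deleting those two
-- parts leaves a partition into parts ≤ t + 1 of a smaller number, and adding parts 1 shows that there
-- are at most as many of these as there are μ of the second kind.

module Submission where

open import Defs
open import Data.Nat using (ℕ; _≥_)
open import Data.Nat.Base using (zero; suc; _+_; _∸_; _⊓_; _≤_; _<_; z≤n; s≤s; _≡ᵇ_; _<ᵇ_)
open import Data.Nat.Properties
open import Data.Nat.Induction using (<-rec)
open import Data.Nat.ListAction using (sum)
open import Data.Nat.ListAction.Properties using (sum-++)
open import Data.List using (List; []; _∷_; _++_; [_]; map; concatMap; filter; upTo; applyUpTo; zip; length; replicate)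
open import Data.List.Properties using (map-++; map-∘; map-cong; filter-++; filter-accept; filter-reject; concatMap-cong; upTo-∷ʳ; ++-identityʳ)
open import Data.List.Relation.Unary.All as All using (All; []; _∷_)
open import Data.List.Relation.Unary.All.Properties using (map⁺; concat⁺; all-filter; filter⁺; applyUpTo⁺₁; replicate⁺)
open import Data.Bool using (true; false; if_then_else_; not; T)
open import Data.Bool.Properties using () renaming (_≟_ to _≟ᵇ_)
open import Data.Product using (_×_; _,_; proj₁; proj₂)
open import Data.Sum using (inj₁; inj₂)
open import Data.Unit using (⊤; tt)
open import Data.Empty using (⊥-elim)
open import Function using (_∘_; id)
open import Relation.Nullary using (Dec; yes; no)
open import Relation.Nullary.Reflects using (Reflects; ofʸ; ofⁿ)
open import Relation.Unary using (Decidable)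
open import Relation.Binary.PropositionalEquality hiding ([_])
open import Algebra.Properties.CommutativeSemigroup +-commutativeSemigroup using (interchange)

sum-map-mono : ∀ {A : Set} {f g : A → ℕ} {xs} → All (λ x → f x ≤ g x) xs → sum (map f xs) ≤ sum (map g xs)
sum-map-mono []         = ≤-refl
sum-map-mono (fx≤gx ∷ p) = +-mono-≤ fx≤gx (sum-map-mono p)

sum-map-cong : ∀ {A : Set} {f g : A → ℕ} {xs} → All (λ x → f x ≡ g x) xs → sum (map f xs) ≡ sum (map g xs)
sum-map-cong []          = refl
sum-map-cong (fx≡gx ∷ p) = cong₂ _+_ fx≡gx (sum-map-cong p)

sum-map-+ : ∀ {A : Set} (f g : A → ℕ) xs → sum (map (λ x → f x + g x) xs) ≡ sum (map f xs) + sum (map g xs)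
sum-map-+ f g []       = refl
sum-map-+ f g (x ∷ xs) = trans (cong (f x + g x +_) (sum-map-+ f g xs)) (interchange (f x) (g x) _ _)

sum-map-++ : ∀ {A : Set} (f : A → ℕ) xs ys → sum (map f (xs ++ ys)) ≡ sum (map f xs) + sum (map f ys)
sum-map-++ f xs ys = trans (cong sum (map-++ f xs ys)) (sum-++ (map f xs) (map f ys))

sum-upTo-suc : ∀ (f : ℕ → ℕ) k → sum (map f (upTo (suc k))) ≡ sum (map f (upTo k)) + f k
sum-upTo-suc f k = begin
  sum (map f (upTo (suc k)))          ≡⟨ cong (sum ∘ map f) (upTo-∷ʳ k) ⟨
  sum (map f (upTo k ++ [ k ]))       ≡⟨ sum-map-++ f (upTo k) [ k ] ⟩
  sum (map f (upTo k)) + (f k + 0)    ≡⟨ cong (sum (map f (upTo k)) +_) (+-identityʳ (f k)) ⟩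
  sum (map f (upTo k)) + f k          ∎
  where open ≡-Reasoning

sum-upTo-monoʳ : ∀ (f : ℕ → ℕ) {k k′} → k ≤ k′ → sum (map f (upTo k)) ≤ sum (map f (upTo k′))
sum-upTo-monoʳ f {k} {zero} z≤n = ≤-refl
sum-upTo-monoʳ f {k} {suc k′} k≤1+k′ with m≤n⇒m<n∨m≡n k≤1+k′
... | inj₂ refl = ≤-refl
... | inj₁ (s≤s k≤k′) = begin
  sum (map f (upTo k))                 ≤⟨ sum-upTo-monoʳ f k≤k′ ⟩
  sum (map f (upTo k′))                ≤⟨ m≤m+n _ (f k′) ⟩
  sum (map f (upTo k′)) + f k′         ≡⟨ sum-upTo-suc f k′ ⟨
  sum (map f (upTo (suc k′)))          ∎
  where open ≤-Reasoning

sum-map-zero : ∀ {A : Set} (xs : List A) → sum (map (λ _ → 0) xs) ≡ 0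
sum-map-zero []       = refl
sum-map-zero (_ ∷ xs) = sum-map-zero xs

if-mono : ∀ b {x y} → x ≤ y → (if b then x else 0) ≤ (if b then y else 0)
if-mono true  x≤y = x≤y
if-mono false _   = ≤-refl

if-≤ : ∀ b x → (if b then x else 0) ≤ x
if-≤ true  x = ≤-refl
if-≤ false x = z≤n

if-0 : ∀ b → (if b then 0 else 0) ≡ 0
if-0 true  = refl
if-0 false = refl

indicator-≢ : ∀ {a k} → a ≢ k → indicator (a ≡ᵇ k) ≡ 0
indicator-≢ {a} {k} a≢k with a ≡ᵇ k in a≡ᵇk
... | false = refl
... | true  = ⊥-elim (a≢k (≡ᵇ⇒≡ a k (subst T (sym a≡ᵇk) tt)))

≡ᵇ0-antitone : ∀ {a b} → a ≤ b → indicator (b ≡ᵇ 0) ≤ indicator (a ≡ᵇ 0)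
≡ᵇ0-antitone {b = zero}  z≤n = ≤-refl
≡ᵇ0-antitone {b = suc b} _   = z≤n

indicator-≡ᵇ+<ᵇ : ∀ k n → indicator (n ≡ᵇ k) + indicator (k <ᵇ n) ≡ indicator (k <ᵇ suc n)
indicator-≡ᵇ+<ᵇ zero    zero    = refl
indicator-≡ᵇ+<ᵇ zero    (suc n) = refl
indicator-≡ᵇ+<ᵇ (suc k) zero    = refl
indicator-≡ᵇ+<ᵇ (suc k) (suc n) = indicator-≡ᵇ+<ᵇ k n

isOdd-suc : ∀ n → isOdd (suc n) ≡ not (isOdd n)
isOdd-suc zero          = refl
isOdd-suc (suc zero)    = refl
isOdd-suc (suc (suc n)) = isOdd-suc n

Decreasing≤ : ℕ → List ℕ → Set
Decreasing≤ m []       = ⊤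
Decreasing≤ m (x ∷ xs) = x ≤ m × Decreasing≤ x xs

decreasing⇒bounded : ∀ {m} xs → Decreasing≤ m xs → All (_≤ m) xs
decreasing⇒bounded []       tt           = []
decreasing⇒bounded (x ∷ xs) (x≤m , dxs) = x≤m ∷ All.map (λ y≤x → ≤-trans y≤x x≤m) (decreasing⇒bounded xs dxs)

partsBounded-decreasing : ∀ f n m → All (Decreasing≤ m) (partsBounded f n m)
partsBounded-decreasing _       zero    m = tt ∷ []
partsBounded-decreasing zero    (suc n) m = []
partsBounded-decreasing (suc f) (suc n) m =
  concat⁺ (map⁺ (All.map withLargest (all-filter (λ p → suc p ≤? m) (upTo (suc n)))))
  where
  withLargest : ∀ {p} → suc p ≤ m → All (Decreasing≤ m) (map (suc p ∷_) (partsBounded f (n ∸ p) (suc p)))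
  withLargest {p} p<m = map⁺ (All.map (p<m ,_) (partsBounded-decreasing f (n ∸ p) (suc p)))

partsBounded-fuel : ∀ {f g} n m → n ≤ f → n ≤ g → partsBounded f n m ≡ partsBounded g n m
partsBounded-fuel         zero    m _         _         = refl
partsBounded-fuel {suc f} {suc g} (suc n) m (s≤s n≤f) (s≤s n≤g) =
  concatMap-cong (λ p → cong (map (suc p ∷_))
                   (partsBounded-fuel (n ∸ p) (suc p) (≤-trans (m∸n≤m n p) n≤f) (≤-trans (m∸n≤m n p) n≤g)))
    (filter (λ p → suc p ≤? m) (upTo (suc n)))

oddParts? : Decidable (λ xs → allB xs ≡ true)
oddParts? xs = allB xs ≟ᵇ true

oddPartitions : ℕ → ℕ → List (List ℕ)
oddPartitions n m = filter oddParts? (partsBounded n n m)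

ΣOdd : (List ℕ → ℕ) → ℕ → ℕ → ℕ
ΣOdd F n m = sum (map F (oddPartitions n m))

ΣOdd-mono : ∀ {F G : List ℕ → ℕ} n m → (∀ xs → Decreasing≤ m xs → F xs ≤ G xs) → ΣOdd F n m ≤ ΣOdd G n m
ΣOdd-mono n m F≤G = sum-map-mono (All.map (F≤G _) (filter⁺ _ (partsBounded-decreasing n n m)))

ΣOdd-cong : ∀ {F G : List ℕ → ℕ} n m → (∀ xs → Decreasing≤ m xs → F xs ≡ G xs) → ΣOdd F n m ≡ ΣOdd G n m
ΣOdd-cong n m F≡G = sum-map-cong (All.map (F≡G _) (filter⁺ _ (partsBounded-decreasing n n m)))

ΣOdd-+ : ∀ (F G : List ℕ → ℕ) n m → ΣOdd (λ xs → F xs + G xs) n m ≡ ΣOdd F n m + ΣOdd G n m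
ΣOdd-+ F G n m = sum-map-+ F G (oddPartitions n m)

ΣOdd-zero : ∀ n m → ΣOdd (λ _ → 0) n m ≡ 0
ΣOdd-zero n m = sum-map-zero (oddPartitions n m)

ΣLargest : (List ℕ → ℕ) → ℕ → ℕ → ℕ
ΣLargest F v k = if isOdd v then ΣOdd (λ ν → F (v ∷ ν)) k v else 0

sum-filter-concatMap : ∀ {A B : Set} {P : B → Set} (P? : Decidable P) (F : B → ℕ) (g : A → List B) xs →
  sum (map F (filter P? (concatMap g xs))) ≡ sum (map (λ x → sum (map F (filter P? (g x)))) xs)
sum-filter-concatMap P? F g []       = refl
sum-filter-concatMap P? F g (x ∷ xs) = begin
  sum (map F (filter P? (g x ++ concatMap g xs)))
    ≡⟨ cong (sum ∘ map F) (filter-++ P? (g x) (concatMap g xs)) ⟩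
  sum (map F (filter P? (g x) ++ filter P? (concatMap g xs)))
    ≡⟨ sum-map-++ F (filter P? (g x)) _ ⟩
  sum (map F (filter P? (g x))) + sum (map F (filter P? (concatMap g xs)))
    ≡⟨ cong (sum (map F (filter P? (g x))) +_) (sum-filter-concatMap P? F g xs) ⟩
  sum (map F (filter P? (g x))) + sum (map (λ x → sum (map F (filter P? (g x)))) xs) ∎
  where open ≡-Reasoning

filter-oddParts-cons : ∀ x L →
  filter oddParts? (map (x ∷_) L) ≡ (if isOdd x then map (x ∷_) (filter oddParts? L) else [])
filter-oddParts-cons x L with isOdd x in odd-x
... | true = kept L
  where
  kept : ∀ L → filter oddParts? (map (x ∷_) L) ≡ map (x ∷_) (filter oddParts? L)
  kept []      = refl
  kept (l ∷ L) rewrite odd-x with allB l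
  ... | true  = cong ((x ∷ l) ∷_) (kept L)
  ... | false = kept L
... | false = dropped L
  where
  dropped : ∀ L → filter oddParts? (map (x ∷_) L) ≡ []
  dropped []      = refl
  dropped (l ∷ L) rewrite odd-x = dropped L

filter-bounded-upTo : ∀ m k → filter (λ p → suc p ≤? m) (upTo k) ≡ upTo (k ⊓ m)
filter-bounded-upTo m zero    = refl
filter-bounded-upTo m (suc k) = begin
  filter P (upTo (suc k))              ≡⟨ cong (filter P) (upTo-∷ʳ k) ⟨
  filter P (upTo k ++ [ k ])           ≡⟨ filter-++ P (upTo k) [ k ] ⟩
  filter P (upTo k) ++ filter P [ k ]  ≡⟨ cong (_++ filter P [ k ]) (filter-bounded-upTo m k) ⟩
  upTo (k ⊓ m) ++ filter P [ k ]       ≡⟨ last (suc k ≤? m) ⟩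
  upTo (suc k ⊓ m)                     ∎
  where
  open ≡-Reasoning
  P = λ p → suc p ≤? m
  last : Dec (suc k ≤ m) → upTo (k ⊓ m) ++ filter P [ k ] ≡ upTo (suc k ⊓ m)
  last (yes k<m) rewrite filter-accept P {xs = []} k<m | m≤n⇒m⊓n≡m k<m | m≤n⇒m⊓n≡m (<⇒≤ k<m) = upTo-∷ʳ k
  last (no k≮m)
    rewrite filter-reject P {xs = []} k≮m | m≥n⇒m⊓n≡n (≮⇒≥ k≮m) | m≥n⇒m⊓n≡n (m≤n⇒m≤1+n (≮⇒≥ k≮m)) =
    ++-identityʳ (upTo m)

ΣOdd-suc : ∀ F n m → ΣOdd F (suc n) m ≡ sum (map (λ p → ΣLargest F (suc p) (n ∸ p)) (upTo (suc n ⊓ m)))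
ΣOdd-suc F n m = begin
  ΣOdd F (suc n) m
    ≡⟨ sum-filter-concatMap oddParts? F block (filter (λ p → suc p ≤? m) (upTo (suc n))) ⟩
  sum (map blockΣ (filter (λ p → suc p ≤? m) (upTo (suc n))))
    ≡⟨ cong (sum ∘ map blockΣ) (filter-bounded-upTo m (suc n)) ⟩
  sum (map blockΣ (upTo (suc n ⊓ m)))
    ≡⟨ cong sum (map-cong blockΣ≡ΣLargest (upTo (suc n ⊓ m))) ⟩
  sum (map (λ p → ΣLargest F (suc p) (n ∸ p)) (upTo (suc n ⊓ m))) ∎
  where
  open ≡-Reasoning
  block : ℕ → List (List ℕ)
  block p = map (suc p ∷_) (partsBounded n (n ∸ p) (suc p))
  blockΣ : ℕ → ℕ
  blockΣ p = sum (map F (filter oddParts? (block p)))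
  blockΣ≡ΣLargest : ∀ p → blockΣ p ≡ ΣLargest F (suc p) (n ∸ p)
  blockΣ≡ΣLargest p
    rewrite filter-oddParts-cons (suc p) (partsBounded n (n ∸ p) (suc p))
          | partsBounded-fuel {n} {n ∸ p} (n ∸ p) (suc p) (m∸n≤m n p) ≤-refl
    with isOdd (suc p)
  ... | true  = cong sum (sym (map-∘ (filter oddParts? (partsBounded (n ∸ p) (n ∸ p) (suc p)))))
  ... | false = refl

ΣOdd-peel : ∀ F n m → ΣOdd F n (suc m) ≡ ΣOdd F n m + (if m <ᵇ n then ΣLargest F (suc m) (n ∸ suc m) else 0)
ΣOdd-peel F zero    m = sym (+-identityʳ _)
ΣOdd-peel F (suc n) m
  rewrite ΣOdd-suc F n (suc m) | ΣOdd-suc F n m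
  with m <ᵇ suc n | <ᵇ-reflects-< m (suc n)
... | true  | ofʸ (s≤s m≤n)
  rewrite m≥n⇒m⊓n≡n m≤n | m≥n⇒m⊓n≡n (m≤n⇒m≤1+n m≤n) = sum-upTo-suc (λ p → ΣLargest F (suc p) (n ∸ p)) m
... | false | ofⁿ m≮1+n
  rewrite m≤n⇒m⊓n≡m (≮⇒≥ m≮1+n) | m≤n⇒m⊓n≡m (<⇒≤ (≮⇒≥ m≮1+n)) = sym (+-identityʳ _)

ΣOdd-peel-odd : ∀ F n m → isOdd (suc m) ≡ true →
  ΣOdd F n (suc m) ≡ ΣOdd F n m + (if m <ᵇ n then ΣOdd (λ ν → F (suc m ∷ ν)) (n ∸ suc m) (suc m) else 0)
ΣOdd-peel-odd F n m odd rewrite ΣOdd-peel F n m | odd = refl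

ΣOdd-peel-even : ∀ F n m → isOdd (suc m) ≡ false → ΣOdd F n (suc m) ≡ ΣOdd F n m
ΣOdd-peel-even F n m even rewrite ΣOdd-peel F n m | even with m <ᵇ n
... | true  = +-identityʳ _
... | false = +-identityʳ _

ΣOdd-split₃ : ∀ F n t → isOdd (suc t) ≡ true →
  ΣOdd F n (3 + t) ≡ ΣOdd F n t
                   + (if t <ᵇ n then ΣOdd (λ ν → F (1 + t ∷ ν)) (n ∸ (1 + t)) (1 + t) else 0)
                   + (if 2 + t <ᵇ n then ΣOdd (λ ν → F (3 + t ∷ ν)) (n ∸ (3 + t)) (3 + t) else 0)
ΣOdd-split₃ F n t odd = begin
  ΣOdd F n (3 + t)          ≡⟨ ΣOdd-peel-odd F n (2 + t) odd ⟩
  ΣOdd F n (2 + t) + large  ≡⟨ cong (_+ large) (ΣOdd-peel-even F n (1 + t) (trans (isOdd-suc (suc t)) (cong not odd))) ⟩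
  ΣOdd F n (1 + t) + large  ≡⟨ cong (_+ large) (ΣOdd-peel-odd F n t odd) ⟩
  ΣOdd F n t + middle + large ∎
  where
  open ≡-Reasoning
  middle large : ℕ
  middle = if t <ᵇ n then ΣOdd (λ ν → F (1 + t ∷ ν)) (n ∸ (1 + t)) (1 + t) else 0
  large  = if 2 + t <ᵇ n then ΣOdd (λ ν → F (3 + t ∷ ν)) (n ∸ (3 + t)) (3 + t) else 0

ΣOdd-ones : ∀ F k → ΣOdd F k 1 ≡ F (replicate k 1)
ΣOdd-ones F zero    = +-identityʳ (F [])
ΣOdd-ones F (suc k) rewrite ΣOdd-suc F k 1 | ⊓-zeroʳ k = trans (+-identityʳ _) (ΣOdd-ones (λ ν → F (1 ∷ ν)) k)

count : ℕ → ℕ → ℕ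
count = ΣOdd (λ _ → 1)

count-suc-mono : ∀ n m → 1 ≤ m → count n m ≤ count (suc n) m
count-suc-mono = <-rec _ step
  where
  step : ∀ n → (∀ {k} → k < n → ∀ m → 1 ≤ m → count k m ≤ count (suc k) m) → ∀ m → 1 ≤ m → count n m ≤ count (suc n) m
  step zero    _   (suc m) _   = ≤-refl
  step (suc n) rec m       1≤m rewrite ΣOdd-suc (λ _ → 1) n m | ΣOdd-suc (λ _ → 1) (suc n) m = begin
    sum (map (block n) (upTo (suc n ⊓ m)))             ≤⟨ sum-map-mono (applyUpTo⁺₁ id (suc n ⊓ m) pointwise) ⟩
    sum (map (block (suc n)) (upTo (suc n ⊓ m)))       ≤⟨ sum-upTo-monoʳ (block (suc n)) (⊓-monoˡ-≤ m (n≤1+n (suc n))) ⟩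
    sum (map (block (suc n)) (upTo (suc (suc n) ⊓ m))) ∎
    where
    open ≤-Reasoning
    block : ℕ → ℕ → ℕ
    block a p = ΣLargest (λ _ → 1) (suc p) (a ∸ p)
    pointwise : ∀ {p} → p < suc n ⊓ m → block n p ≤ block (suc n) p
    pointwise {p} p<1+n⊓m rewrite +-∸-assoc 1 (≤-pred (≤-trans p<1+n⊓m (m⊓n≤m (suc n) m))) =
      if-mono (isOdd (suc p)) (rec (s≤s (m∸n≤m n p)) (suc p) (s≤s z≤n))

count-mono : ∀ {a b} m → 1 ≤ m → a ≤ b → count a m ≤ count b m
count-mono {b = zero}  m 1≤m z≤n = ≤-refl
count-mono {b = suc b} m 1≤m a≤1+b with m≤n⇒m<n∨m≡n a≤1+b
... | inj₂ refl       = ≤-refl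
... | inj₁ (s≤s a≤b) = ≤-trans (count-mono m 1≤m a≤b) (count-suc-mono b m 1≤m)

colLen-cons-< : ∀ {x j} μ → j < x → colLen (x ∷ μ) j ≡ suc (colLen μ j)
colLen-cons-< {x} {j} μ j<x with j <ᵇ x | <ᵇ-reflects-< j x
... | true  | _       = refl
... | false | ofⁿ j≮x = ⊥-elim (j≮x j<x)

colLen-cons-≥ : ∀ {x j} μ → x ≤ j → colLen (x ∷ μ) j ≡ colLen μ j
colLen-cons-≥ {x} {j} μ x≤j with j <ᵇ x | <ᵇ-reflects-< j x
... | false | _       = refl
... | true  | ofʸ j<x = ⊥-elim (<⇒≱ j<x x≤j)

colLen-≡0 : ∀ {m j} μ → Decreasing≤ m μ → m ≤ j → colLen μ j ≡ 0
colLen-≡0 []      _             _   = refl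
colLen-≡0 (x ∷ μ) (x≤m , dμ) m≤j = trans (colLen-cons-≥ μ (≤-trans x≤m m≤j)) (colLen-≡0 μ dμ (≤-trans x≤m m≤j))

colLen-antitone : ∀ μ j → colLen μ (suc j) ≤ colLen μ j
colLen-antitone []      j = z≤n
colLen-antitone (x ∷ μ) j with suc j <ᵇ x | <ᵇ-reflects-< (suc j) x | j <ᵇ x | <ᵇ-reflects-< j x
... | true  | ofʸ _     | true  | _         = s≤s (colLen-antitone μ j)
... | true  | ofʸ 1+j<x | false | ofⁿ j≮x   = ⊥-elim (j≮x (<-trans (n<1+n j) 1+j<x))
... | false | _         | true  | _         = m≤n⇒m≤1+n (colLen-antitone μ j)
... | false | _         | false | _         = colLen-antitone μ j

rowHooks : ℕ → List ℕ → ℕ → ℕ → ℕ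
rowHooks k λs i r = sum (map (λ j → indicator (hook λs i r j ≡ᵇ k)) (upTo r))

rowHooksSum : ℕ → List ℕ → (ℕ → ℕ) → List ℕ → ℕ
rowHooksSum k λs g []       = 0
rowHooksSum k λs g (r ∷ rs) = rowHooks k λs (g 0) r + rowHooksSum k λs (g ∘ suc) rs

sum-zip-rowHooks : ∀ k λs g rs →
  sum (map (λ ir → rowHooks k λs (proj₁ ir) (proj₂ ir)) (zip (applyUpTo g (length rs)) rs)) ≡ rowHooksSum k λs g rs
sum-zip-rowHooks k λs g []       = refl
sum-zip-rowHooks k λs g (r ∷ rs) = cong (rowHooks k λs (g 0) r +_) (sum-zip-rowHooks k λs (g ∘ suc) rs)

rowHooks-cons : ∀ k {x r} μ i → r ≤ x → rowHooks k (x ∷ μ) (suc i) r ≡ rowHooks k μ i r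
rowHooks-cons k {x} {r} μ i r≤x = sum-map-cong (applyUpTo⁺₁ id r below)
  where
  below : ∀ {j} → j < r → indicator (hook (x ∷ μ) (suc i) r j ≡ᵇ k) ≡ indicator (hook μ i r j ≡ᵇ k)
  below {j} j<r rewrite colLen-cons-< μ (<-≤-trans j<r r≤x) = refl

rowHooksSum-cons : ∀ k {x} μ g rs → All (_≤ x) rs → rowHooksSum k (x ∷ μ) (suc ∘ g) rs ≡ rowHooksSum k μ g rs
rowHooksSum-cons k μ g []       []            = refl
rowHooksSum-cons k μ g (r ∷ rs) (r≤x ∷ rs≤x) = cong₂ _+_ (rowHooks-cons k μ (g 0) r≤x) (rowHooksSum-cons k μ (g ∘ suc) rs rs≤x)

hooksEq-cons : ∀ k x μ → All (_≤ x) μ → hooksEq k (x ∷ μ) ≡ rowHooks k (x ∷ μ) 0 x + hooksEq k μ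
hooksEq-cons k x μ μ≤x = begin
  hooksEq k (x ∷ μ)                                  ≡⟨ sum-zip-rowHooks k (x ∷ μ) id (x ∷ μ) ⟩
  rowHooks k (x ∷ μ) 0 x + rowHooksSum k (x ∷ μ) suc μ ≡⟨ cong (rowHooks k (x ∷ μ) 0 x +_) (rowHooksSum-cons k μ id μ μ≤x) ⟩
  rowHooks k (x ∷ μ) 0 x + rowHooksSum k μ id μ        ≡⟨ cong (rowHooks k (x ∷ μ) 0 x +_) (sum-zip-rowHooks k μ id μ) ⟨
  rowHooks k (x ∷ μ) 0 x + hooksEq k μ               ∎
  where open ≡-Reasoning

hook-top : ∀ {v j} μ → j < v → hook (v ∷ μ) 0 v j ≡ suc (v ∸ suc j + colLen μ j)
hook-top {v} {j} μ j<v rewrite colLen-cons-< μ j<v =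
  trans (cong (λ a → a + colLen μ j + 1) (trans (∸-+-assoc v j 1) (cong (v ∸_) (+-comm j 1)))) (+-comm _ 1)

sum-upTo-+3 : ∀ (f : ℕ → ℕ) t → sum (map f (upTo (3 + t))) ≡ sum (map f (upTo t)) + f t + f (1 + t) + f (2 + t)
sum-upTo-+3 f t = begin
  sum (map f (upTo (3 + t)))                              ≡⟨ sum-upTo-suc f (2 + t) ⟩
  sum (map f (upTo (2 + t))) + f (2 + t)                  ≡⟨ cong (_+ f (2 + t)) (sum-upTo-suc f (1 + t)) ⟩
  sum (map f (upTo (1 + t))) + f (1 + t) + f (2 + t)      ≡⟨ cong (λ s → s + f (1 + t) + f (2 + t)) (sum-upTo-suc f t) ⟩
  sum (map f (upTo t)) + f t + f (1 + t) + f (2 + t)      ∎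
  where open ≡-Reasoning

topRowHooks : ℕ → ℕ → List ℕ → ℕ
topRowHooks k t μ = indicator (3 + colLen μ t ≡ᵇ k) + indicator (2 + colLen μ (1 + t) ≡ᵇ k) + indicator (1 + colLen μ (2 + t) ≡ᵇ k)

-- Only the last three boxes of a row of length t + 3 can have a hook of length at most 3.
rowHooks-top : ∀ k t μ → k ≤ 3 → rowHooks k (3 + t ∷ μ) 0 (3 + t) ≡ topRowHooks k t μ
rowHooks-top k t μ k≤3 = begin
  rowHooks k (3 + t ∷ μ) 0 (3 + t)                       ≡⟨ sum-upTo-+3 boxHook t ⟩
  sum (map boxHook (upTo t)) + boxHook t + boxHook (1 + t) + boxHook (2 + t)
    ≡⟨ cong (λ s → s + boxHook t + boxHook (1 + t) + boxHook (2 + t)) leftPart ⟩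
  boxHook t + boxHook (1 + t) + boxHook (2 + t)
    ≡⟨ cong₂ (λ a b → a + b + boxHook (2 + t)) (boxHook-at t 2 (m+n∸n≡m 2 t) (m≤n+m (suc t) 2))
                                                (boxHook-at (1 + t) 1 (m+n∸n≡m 1 t) (s≤s (m≤n+m (suc t) 1))) ⟩
  indicator (3 + colLen μ t ≡ᵇ k) + indicator (2 + colLen μ (1 + t) ≡ᵇ k) + boxHook (2 + t)
    ≡⟨ cong (indicator (3 + colLen μ t ≡ᵇ k) + indicator (2 + colLen μ (1 + t) ≡ᵇ k) +_)
            (boxHook-at (2 + t) 0 (n∸n≡0 t) ≤-refl) ⟩
  topRowHooks k t μ ∎
  where
  open ≡-Reasoning
  boxHook : ℕ → ℕ
  boxHook j = indicator (hook (3 + t ∷ μ) 0 (3 + t) j ≡ᵇ k)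
  boxHook-at : ∀ j a → 2 + t ∸ j ≡ a → j < 3 + t → boxHook j ≡ indicator (suc (a + colLen μ j) ≡ᵇ k)
  boxHook-at j a arm j<3+t = cong (λ h → indicator (h ≡ᵇ k)) (trans (hook-top μ j<3+t) (cong (λ a → suc (a + colLen μ j)) arm))
  leftPart : sum (map boxHook (upTo t)) ≡ 0
  leftPart = trans (sum-map-cong (applyUpTo⁺₁ id t far)) (sum-map-zero (upTo t))
    where
    far : ∀ {j} → j < t → boxHook j ≡ 0
    far {j} j<t = trans (boxHook-at j _ refl (<-trans j<t (m≤n+m (suc t) 2)))
      (indicator-≢ (>⇒≢ (s≤s (≤-trans k≤3 (≤-trans 3≤arm (m≤m+n _ (colLen μ j)))))))
      where
      3≤arm : 3 ≤ 2 + t ∸ j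
      3≤arm rewrite +-∸-assoc 2 (<⇒≤ j<t) = +-monoʳ-≤ 2 (m<n⇒0<n∸m j<t)

colLen-ones : ∀ n → colLen (replicate n 1) 0 ≡ n
colLen-ones zero    = refl
colLen-ones (suc n) = cong suc (colLen-ones n)

hooksEq-ones : ∀ k n → hooksEq (suc k) (replicate n 1) ≡ indicator (k <ᵇ n)
hooksEq-ones k zero    = refl
hooksEq-ones k (suc n) = begin
  hooksEq (suc k) (1 ∷ replicate n 1)
    ≡⟨ hooksEq-cons (suc k) 1 (replicate n 1) (replicate⁺ n ≤-refl) ⟩
  indicator (hook (1 ∷ replicate n 1) 0 1 0 ≡ᵇ suc k) + 0 + hooksEq (suc k) (replicate n 1)
    ≡⟨ cong₂ _+_ topBox (hooksEq-ones k n) ⟩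
  indicator (n ≡ᵇ k) + indicator (k <ᵇ n)
    ≡⟨ indicator-≡ᵇ+<ᵇ k n ⟩
  indicator (k <ᵇ suc n) ∎
  where
  open ≡-Reasoning
  topBox : indicator (hook (1 ∷ replicate n 1) 0 1 0 ≡ᵇ suc k) + 0 ≡ indicator (n ≡ᵇ k)
  topBox = trans (+-identityʳ _) (cong (λ h → indicator (h ≡ᵇ suc k))
                                       (trans (hook-top (replicate n 1) (s≤s z≤n)) (cong suc (colLen-ones n))))

hooks₃≤hooks₂-ones : ∀ n → hooksEq 3 (replicate n 1) ≤ hooksEq 2 (replicate n 1)
hooks₃≤hooks₂-ones n rewrite hooksEq-ones 2 n | hooksEq-ones 1 n = <ᵇ-antitone n
  where
  <ᵇ-antitone : ∀ n → indicator (2 <ᵇ n) ≤ indicator (1 <ᵇ n)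
  <ᵇ-antitone 0                   = z≤n
  <ᵇ-antitone 1                   = z≤n
  <ᵇ-antitone 2                   = z≤n
  <ᵇ-antitone (suc (suc (suc n))) = ≤-refl

noPartAbove onePartAbove : ℕ → List ℕ → ℕ
noPartAbove  b ν = indicator (colLen ν b ≡ᵇ 0)
onePartAbove b ν = indicator (colLen ν b ≡ᵇ 1)

-- topRowHooks 3 t and topRowHooks 2 t, evaluated (a box of hook 3 + c never has hook 2).
topRow₃ topRow₂ : ℕ → List ℕ → ℕ
topRow₃ t μ = indicator (colLen μ t ≡ᵇ 0) + indicator (colLen μ (1 + t) ≡ᵇ 1) + indicator (colLen μ (2 + t) ≡ᵇ 2)
topRow₂ t μ = indicator (colLen μ (1 + t) ≡ᵇ 0) + indicator (colLen μ (2 + t) ≡ᵇ 1)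

module _ (t : ℕ) (odd : isOdd (suc t) ≡ true) where

  private
    t<3+t : t < 3 + t
    t<3+t = m≤n+m (suc t) 2

    1+t<3+t : 1 + t < 3 + t
    1+t<3+t = s≤s (m≤n+m (suc t) 1)

    2+t<3+t : 2 + t < 3 + t
    2+t<3+t = ≤-refl

  ΣOdd-noPartAbove : ∀ k → ΣOdd (noPartAbove (2 + t)) k (3 + t) ≡ count k (1 + t)
  ΣOdd-noPartAbove k = begin
    ΣOdd (noPartAbove (2 + t)) k (3 + t)
      ≡⟨ ΣOdd-split₃ _ k t odd ⟩
    ΣOdd (noPartAbove (2 + t)) k t + _ + _
      ≡⟨ cong₂ _+_ (cong₂ _+_ short (cong (λ x → if t <ᵇ k then x else 0) middle))
                   (trans (cong (λ x → if 2 + t <ᵇ k then x else 0) (trans large (ΣOdd-zero (k ∸ (3 + t)) (3 + t)))) (if-0 _)) ⟩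
    count k t + (if t <ᵇ k then count (k ∸ (1 + t)) (1 + t) else 0) + 0
      ≡⟨ +-identityʳ _ ⟩
    count k t + (if t <ᵇ k then count (k ∸ (1 + t)) (1 + t) else 0)
      ≡⟨ ΣOdd-peel-odd (λ _ → 1) k t odd ⟨
    count k (1 + t) ∎
    where
    open ≡-Reasoning
    short : ΣOdd (noPartAbove (2 + t)) k t ≡ count k t
    short = ΣOdd-cong k t λ μ dμ → cong (λ c → indicator (c ≡ᵇ 0)) (colLen-≡0 μ dμ (m≤n+m t 2))
    middle : ΣOdd (λ ν → noPartAbove (2 + t) (1 + t ∷ ν)) (k ∸ (1 + t)) (1 + t) ≡ count (k ∸ (1 + t)) (1 + t)
    middle = ΣOdd-cong (k ∸ (1 + t)) (1 + t) λ ν dν →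
      cong (λ c → indicator (c ≡ᵇ 0)) (colLen-≡0 (1 + t ∷ ν) (≤-refl , dν) (n≤1+n (1 + t)))
    large : ΣOdd (λ ν → noPartAbove (2 + t) (3 + t ∷ ν)) (k ∸ (3 + t)) (3 + t) ≡ ΣOdd (λ _ → 0) (k ∸ (3 + t)) (3 + t)
    large = ΣOdd-cong (k ∸ (3 + t)) (3 + t) λ ν _ → cong (λ c → indicator (c ≡ᵇ 0)) (colLen-cons-< ν 2+t<3+t)

  ΣOdd-onePartAbove : ∀ k → ΣOdd (onePartAbove (2 + t)) k (3 + t) ≡ (if 2 + t <ᵇ k then count (k ∸ (3 + t)) (1 + t) else 0)
  ΣOdd-onePartAbove k = begin
    ΣOdd (onePartAbove (2 + t)) k (3 + t)
      ≡⟨ ΣOdd-split₃ _ k t odd ⟩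
    ΣOdd (onePartAbove (2 + t)) k t + _ + _
      ≡⟨ cong₂ _+_ (cong₂ _+_ (trans short (ΣOdd-zero k t))
                              (trans (cong (λ x → if t <ᵇ k then x else 0) (trans middle (ΣOdd-zero (k ∸ (1 + t)) (1 + t)))) (if-0 _)))
                   (cong (λ x → if 2 + t <ᵇ k then x else 0) (trans large (ΣOdd-noPartAbove (k ∸ (3 + t))))) ⟩
    (if 2 + t <ᵇ k then count (k ∸ (3 + t)) (1 + t) else 0) ∎
    where
    open ≡-Reasoning
    short : ΣOdd (onePartAbove (2 + t)) k t ≡ ΣOdd (λ _ → 0) k t
    short = ΣOdd-cong k t λ μ dμ → cong (λ c → indicator (c ≡ᵇ 1)) (colLen-≡0 μ dμ (m≤n+m t 2))
    middle : ΣOdd (λ ν → onePartAbove (2 + t) (1 + t ∷ ν)) (k ∸ (1 + t)) (1 + t) ≡ ΣOdd (λ _ → 0) (k ∸ (1 + t)) (1 + t)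
    middle = ΣOdd-cong (k ∸ (1 + t)) (1 + t) λ ν dν →
      cong (λ c → indicator (c ≡ᵇ 1)) (colLen-≡0 (1 + t ∷ ν) (≤-refl , dν) (n≤1+n (1 + t)))
    large : ΣOdd (λ ν → onePartAbove (2 + t) (3 + t ∷ ν)) (k ∸ (3 + t)) (3 + t) ≡ ΣOdd (noPartAbove (2 + t)) (k ∸ (3 + t)) (3 + t)
    large = ΣOdd-cong (k ∸ (3 + t)) (3 + t) λ ν _ → cong (λ c → indicator (c ≡ᵇ 1)) (colLen-cons-< ν 2+t<3+t)

  topRow₃≡topRow₂-short : ∀ μ → Decreasing≤ t μ → topRow₃ t μ ≡ topRow₂ t μ
  topRow₃≡topRow₂-short μ dμ
    rewrite colLen-≡0 μ dμ (≤-refl {t}) | colLen-≡0 μ dμ (n≤1+n t) | colLen-≡0 μ dμ (m≤n+m t 2) = refl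

  topRow₃-middle : ∀ ν → Decreasing≤ (1 + t) ν → topRow₃ t (1 + t ∷ ν) ≡ 0
  topRow₃-middle ν dν
    rewrite colLen-cons-< ν (n<1+n t)
          | colLen-≡0 (1 + t ∷ ν) (≤-refl , dν) (≤-refl {1 + t})
          | colLen-≡0 (1 + t ∷ ν) (≤-refl , dν) (n≤1+n (1 + t)) = refl

  topRow₂-middle : ∀ ν → Decreasing≤ (1 + t) ν → topRow₂ t (1 + t ∷ ν) ≡ 1
  topRow₂-middle ν dν
    rewrite colLen-≡0 (1 + t ∷ ν) (≤-refl , dν) (≤-refl {1 + t})
          | colLen-≡0 (1 + t ∷ ν) (≤-refl , dν) (n≤1+n (1 + t)) = refl

  topRow₃-large : ∀ ν → topRow₃ t (3 + t ∷ ν) ≤ topRow₂ t (3 + t ∷ ν) + onePartAbove (2 + t) ν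
  topRow₃-large ν
    rewrite colLen-cons-< ν t<3+t | colLen-cons-< ν 1+t<3+t | colLen-cons-< ν 2+t<3+t =
    +-monoˡ-≤ (onePartAbove (2 + t) ν) (≡ᵇ0-antitone (colLen-antitone ν (1 + t)))

  ΣOdd-topRow₃-large : ∀ k K → k ≤ K →
    ΣOdd (λ ν → topRow₃ t (3 + t ∷ ν)) k (3 + t) ≤ ΣOdd (λ ν → topRow₂ t (3 + t ∷ ν)) k (3 + t) + count K (1 + t)
  ΣOdd-topRow₃-large k K k≤K = begin
    ΣOdd (λ ν → topRow₃ t (3 + t ∷ ν)) k (3 + t)
      ≤⟨ ΣOdd-mono k (3 + t) (λ ν _ → topRow₃-large ν) ⟩
    ΣOdd (λ ν → topRow₂ t (3 + t ∷ ν) + onePartAbove (2 + t) ν) k (3 + t)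
      ≡⟨ ΣOdd-+ (λ ν → topRow₂ t (3 + t ∷ ν)) (onePartAbove (2 + t)) k (3 + t) ⟩
    Y₂ + ΣOdd (onePartAbove (2 + t)) k (3 + t)
      ≡⟨ cong (Y₂ +_) (ΣOdd-onePartAbove k) ⟩
    Y₂ + (if 2 + t <ᵇ k then count (k ∸ (3 + t)) (1 + t) else 0)
      ≤⟨ +-monoʳ-≤ Y₂ (if-≤ _ _) ⟩
    Y₂ + count (k ∸ (3 + t)) (1 + t)
      ≤⟨ +-monoʳ-≤ Y₂ (count-mono (1 + t) (s≤s z≤n) (≤-trans (m∸n≤m k (3 + t)) k≤K)) ⟩
    Y₂ + count K (1 + t) ∎
    where
    open ≤-Reasoning
    Y₂ : ℕ
    Y₂ = ΣOdd (λ ν → topRow₂ t (3 + t ∷ ν)) k (3 + t)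

  ΣOdd-topRow₃≤topRow₂ : ∀ n → ΣOdd (topRow₃ t) n (3 + t) ≤ ΣOdd (topRow₂ t) n (3 + t)
  ΣOdd-topRow₃≤topRow₂ n = begin
    ΣOdd (topRow₃ t) n (3 + t)
      ≡⟨ ΣOdd-split₃ (topRow₃ t) n t odd ⟩
    A₃ + (if t <ᵇ n then X₃ else 0) + (if 2 + t <ᵇ n then Y₃ else 0)
      ≤⟨ pieces (t <ᵇ n) (2 + t <ᵇ n) (<ᵇ-reflects-< t n) (<ᵇ-reflects-< (2 + t) n) ⟩
    A₂ + (if t <ᵇ n then X₂ else 0) + (if 2 + t <ᵇ n then Y₂ else 0)
      ≡⟨ ΣOdd-split₃ (topRow₂ t) n t odd ⟨
    ΣOdd (topRow₂ t) n (3 + t) ∎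
    where
    open ≤-Reasoning
    A₃ A₂ X₃ X₂ Y₃ Y₂ : ℕ
    A₃ = ΣOdd (topRow₃ t) n t
    A₂ = ΣOdd (topRow₂ t) n t
    X₃ = ΣOdd (λ ν → topRow₃ t (1 + t ∷ ν)) (n ∸ (1 + t)) (1 + t)
    X₂ = ΣOdd (λ ν → topRow₂ t (1 + t ∷ ν)) (n ∸ (1 + t)) (1 + t)
    Y₃ = ΣOdd (λ ν → topRow₃ t (3 + t ∷ ν)) (n ∸ (3 + t)) (3 + t)
    Y₂ = ΣOdd (λ ν → topRow₂ t (3 + t ∷ ν)) (n ∸ (3 + t)) (3 + t)

    A₃≡A₂ : A₃ ≡ A₂
    A₃≡A₂ = ΣOdd-cong n t topRow₃≡topRow₂-short

    X₃≡0 : X₃ ≡ 0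
    X₃≡0 = trans (ΣOdd-cong (n ∸ (1 + t)) (1 + t) topRow₃-middle) (ΣOdd-zero (n ∸ (1 + t)) (1 + t))

    Y₃≤Y₂+X₂ : Y₃ ≤ Y₂ + X₂
    Y₃≤Y₂+X₂ = subst (λ x → Y₃ ≤ Y₂ + x) (sym (ΣOdd-cong (n ∸ (1 + t)) (1 + t) topRow₂-middle))
      (ΣOdd-topRow₃-large (n ∸ (3 + t)) (n ∸ (1 + t)) (∸-monoʳ-≤ n (<⇒≤ 1+t<3+t)))

    pieces : ∀ b b′ → Reflects (t < n) b → Reflects (2 + t < n) b′ →
      A₃ + (if b then X₃ else 0) + (if b′ then Y₃ else 0) ≤ A₂ + (if b then X₂ else 0) + (if b′ then Y₂ else 0)
    pieces b     false _          _ = +-mono-≤ (+-mono-≤ (≤-reflexive A₃≡A₂) (if-mono b (subst (_≤ X₂) (sym X₃≡0) z≤n))) z≤n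
    pieces false true  (ofⁿ t≮n) (ofʸ 2+t<n) = ⊥-elim (t≮n (<-trans (m≤n+m (suc t) 1) 2+t<n))
    pieces true  true  _          _ = begin
      A₃ + X₃ + Y₃      ≡⟨ cong (λ x → A₃ + x + Y₃) X₃≡0 ⟩
      A₃ + 0 + Y₃       ≡⟨ cong (_+ Y₃) (+-identityʳ A₃) ⟩
      A₃ + Y₃           ≤⟨ +-mono-≤ (≤-reflexive A₃≡A₂) Y₃≤Y₂+X₂ ⟩
      A₂ + (Y₂ + X₂)    ≡⟨ cong (A₂ +_) (+-comm Y₂ X₂) ⟩
      A₂ + (X₂ + Y₂)    ≡⟨ +-assoc A₂ X₂ Y₂ ⟨
      A₂ + X₂ + Y₂      ∎

ΣOdd-hooksEq-top : ∀ k t K → k ≤ 3 →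
  ΣOdd (λ ν → hooksEq k (3 + t ∷ ν)) K (3 + t) ≡ ΣOdd (topRowHooks k t) K (3 + t) + ΣOdd (hooksEq k) K (3 + t)
ΣOdd-hooksEq-top k t K k≤3 = trans (ΣOdd-cong K (3 + t) split) (ΣOdd-+ (topRowHooks k t) (hooksEq k) K (3 + t))
  where
  split : ∀ ν → Decreasing≤ (3 + t) ν → hooksEq k (3 + t ∷ ν) ≡ topRowHooks k t ν + hooksEq k ν
  split ν dν = trans (hooksEq-cons k (3 + t) ν (decreasing⇒bounded ν dν)) (cong (_+ hooksEq k ν) (rowHooks-top k t ν k≤3))

ΣLargest-hooks₃≤hooks₂ : ∀ v k → ΣOdd (hooksEq 3) k v ≤ ΣOdd (hooksEq 2) k v →
  ΣLargest (hooksEq 3) v k ≤ ΣLargest (hooksEq 2) v k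
ΣLargest-hooks₃≤hooks₂ zero k _ = ≤-refl
ΣLargest-hooks₃≤hooks₂ 1    k _
  rewrite ΣOdd-ones (λ ν → hooksEq 3 (1 ∷ ν)) k | ΣOdd-ones (λ ν → hooksEq 2 (1 ∷ ν)) k = hooks₃≤hooks₂-ones (suc k)
ΣLargest-hooks₃≤hooks₂ 2    k _ = ≤-refl
ΣLargest-hooks₃≤hooks₂ (suc (suc (suc t))) k below with isOdd (suc t) in odd
... | false = ≤-refl
... | true  = begin
  ΣOdd (λ ν → hooksEq 3 (3 + t ∷ ν)) k (3 + t)            ≡⟨ ΣOdd-hooksEq-top 3 t k ≤-refl ⟩
  ΣOdd (topRow₃ t) k (3 + t) + ΣOdd (hooksEq 3) k (3 + t)  ≤⟨ +-mono-≤ (ΣOdd-topRow₃≤topRow₂ t odd k) below ⟩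
  ΣOdd (topRow₂ t) k (3 + t) + ΣOdd (hooksEq 2) k (3 + t)  ≡⟨ ΣOdd-hooksEq-top 2 t k (n≤1+n 2) ⟨
  ΣOdd (λ ν → hooksEq 2 (3 + t ∷ ν)) k (3 + t)            ∎
  where open ≤-Reasoning

ΣOdd-hooks₃≤hooks₂ : ∀ n m → ΣOdd (hooksEq 3) n m ≤ ΣOdd (hooksEq 2) n m
ΣOdd-hooks₃≤hooks₂ = <-rec _ step
  where
  step : ∀ n → (∀ {k} → k < n → ∀ m → ΣOdd (hooksEq 3) k m ≤ ΣOdd (hooksEq 2) k m) →
         ∀ m → ΣOdd (hooksEq 3) n m ≤ ΣOdd (hooksEq 2) n m
  step zero    _   m = z≤n
  step (suc n) rec m rewrite ΣOdd-suc (hooksEq 3) n m | ΣOdd-suc (hooksEq 2) n m =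
    sum-map-mono (All.universal (λ p → ΣLargest-hooks₃≤hooks₂ (suc p) (n ∸ p) (rec (s≤s (m∸n≤m n p)) (suc p))) (upTo (suc n ⊓ m)))

theorem1p5 : (n : ℕ) → b2 2 n ≥ b2 3 n
theorem1p5 n = ΣOdd-hooks₃≤hooks₂ n n
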